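{- Let $k\ge 1$ and let $B_1,\dots,B_\ell$ be the blocks of a nontrivial finite simple connected graph $G$. If $X$ is a $k$-ftmv set of $G$ of maximum cardinality $\mathrm{f}\mu^{k}(G)$, then $X\subseteq V(B_i)$ for some $i\in[\ell]$. In particular, $\mathrm{f}\mu^{k}(G)=\max\{\mathrm{f}\mu^{k}(B_i): i\in[\ell]\}$.
   Context: For an integer $k\ge 0$ and a connected graph $G$, a set $X\subseteq V(G)$ is a $k$-fault-tolerant mutual-visibility set ($k$-ftmv set) if for any two non-adjacent vertices $u,v\in X$ there exist $k+1$ internally vertex-disjoint shortest $u,v$-paths $Q_1,\dots,Q_{k+1}$ in $G$ such that $V(Q_i)\cap X=\{u,v\}$ for every $i$. $\mathrm{f}\mu^{k}(G)$ denotes the maximum cardinality of a $k$-ftmv set of $G$. A block of $G$ is a maximal connected subgraph of $G$ without a cut-vertex. -}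

module Defs where

open import Data.Nat using (ℕ; zero; suc; _≤_)
open import Data.Fin using (Fin)
open import Data.Fin.Subset using (Subset; _∈_; _⊆_; _-_; ⊤; ∣_∣; Nonempty)
open import Data.List using (List; []; _∷_)
open import Data.List.Relation.Unary.Unique.Propositional using (Unique)
import Data.List.Membership.Propositional as LM
open import Data.Product using (Σ; ∃; ∃-syntax; _×_; _,_)
open import Data.Sum using (_⊎_)
open import Relation.Nullary using (¬_)
open import Relation.Binary.PropositionalEquality using (_≡_; _≢_)
open import Relation.Binary.Definitions using (Decidable)

record SimpleGraph (n : ℕ) : Set₁ where
  field
    Adj    : Fin n → Fin n → Set
    adj?   : Decidable Adj
    sym    : ∀ {u v} → Adj u v → Adj v u
    irrefl : ∀ {u} → ¬ Adj u u
open SimpleGraph public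

module _ {n : ℕ} (G : SimpleGraph n) where

  -- Walks of length l (number of edges) from u to v in the induced
  -- subgraph G[S] (all vertices of the walk lie in S).
  data Walk (S : Subset n) : Fin n → Fin n → ℕ → Set where
    [_] : ∀ {u} → u ∈ S → Walk S u u zero
    step : ∀ {u w v l} → u ∈ S → Adj G u w → Walk S w v l → Walk S u v (suc l)

  verts : ∀ {S u v l} → Walk S u v l → List (Fin n)
  verts ([_] {u} _) = u ∷ []
  verts (step {u} _ _ W) = u ∷ verts W

  IsShortestPath : ∀ {S u v l} → Walk S u v l → Set
  IsShortestPath {S} {u} {v} {l} P =
    Unique (verts P) × (∀ l' → Walk S u v l' → l ≤ l')

  Connected : Subset n → Set
  Connected S = ∀ {u v} → u ∈ S → v ∈ S → ∃[ l ] Walk S u v l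

  NoCutVertex : Subset n → Set
  NoCutVertex S = ∀ {x} → x ∈ S → Connected (S - x)

  -- B is (the vertex set of) a block of G: a maximal connected subgraph
  -- without a cut-vertex (blocks are induced subgraphs).
  IsBlock : Subset n → Set
  IsBlock B = Nonempty B × Connected B × NoCutVertex B
            × (∀ T → B ⊆ T → Nonempty T → Connected T → NoCutVertex T → T ⊆ B)

  IsFtmv : Subset n → ℕ → Subset n → Set
  IsFtmv S k X =
    X ⊆ S ×
    (∀ {u v} → u ∈ X → v ∈ X → u ≢ v → ¬ Adj G u v →
      Σ (Fin (suc k) → ∃[ l ] Walk S u v l) λ Q →
        (∀ i → let (_ , P) = Q i in
               IsShortestPath P ×
               (∀ {w} → w LM.∈ verts P → w ∈ X → w ≡ u ⊎ w ≡ v)) ×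
        (∀ i j → i ≢ j → let (_ , P) = Q i ; (_ , P') = Q j in
               ∀ {w} → w LM.∈ verts P → w LM.∈ verts P' → w ≡ u ⊎ w ≡ v))

  IsMaxFtmv : Subset n → ℕ → Subset n → Set
  IsMaxFtmv S k X = IsFtmv S k X × (∀ Y → IsFtmv S k Y → ∣ Y ∣ ≤ ∣ X ∣)

  IsFμ : Subset n → ℕ → ℕ → Set
  IsFμ S k m = Σ (Subset n) λ X → IsMaxFtmv S k X × ∣ X ∣ ≡ m

{-# OPTIONS --safe #-}
-- Two vertices of a k-ftmv set with k ≥ 1 are adjacent or joined by two
-- internally disjoint paths, so they lie in a common cycle or edge, i.e. in a
-- nonseparable subgraph.  If u, v ∈ X lie in the block B and x ∈ X is a third
-- vertex, then B together with such subgraphs through u, x and v, x is again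
-- nonseparable, hence inside B by maximality: X lies in one block.
-- Moreover, a shortest path between two vertices of a block never leaves
-- the block, so a subset of a block is a k-ftmv set of the block exactly when
-- it is one of G, and fμ^k(G) is attained in a block.
module Submission where

open import Defs
open import Data.Nat using (ℕ; zero; suc; _≤_; _<_; _+_; _∸_; z≤n; s≤s)
open import Data.Nat.Properties using (≤-refl; ≤-trans; m≤n⇒m≤1+n; +-comm; ∸-monoʳ-<)
open import Data.Nat.Induction using (<-wellFounded)
open import Induction.WellFounded using (Acc; acc)
open import Data.Fin using (Fin; zero; suc; _≟_; toℕ; fromℕ<)
open import Data.Fin.Properties using (any?; all?; injective⇒≤; toℕ-fromℕ<)
open import Data.Fin.Subset
  using (Subset; inside; _∈_; _∉_; _⊆_; _-_; _─_; _∪_; ⊤; ⊥; ⁅_⁆; ∣_∣; Nonempty)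
open import Data.Fin.Subset.Properties
  using (_∈?_; _⊂?_; ∈⊤; ⊆⊤; ∉⊥; x∈⁅x⁆; x∈⁅y⁆⇒x≡y; p⊆p∪q; q⊆p∪q; x∈p∪q⁻; p─q⊆p;
         x∈p∧x≢y⇒x∈p-y; nonempty?; anySubset?; p⊂q⇒∣p∣<∣q∣; ∣p∣≤n)
open import Data.Vec using (here; there) renaming (_∷_ to _∷ᵛ_)
open import Data.List using (List; []; _∷_; length; lookup)
open import Data.List.Relation.Unary.Any using (here; there)
open import Data.List.Relation.Unary.All using (All; []; _∷_)
import Data.List.Relation.Unary.All as All
open import Data.List.Relation.Unary.All.Properties using (¬Any⇒All¬)
open import Data.List.Relation.Unary.AllPairs using ([]; _∷_)
import Data.List.Relation.Unary.AllPairs as AllPairs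
open import Data.List.Relation.Unary.Unique.Propositional using (Unique)
open import Data.List.Membership.Propositional using () renaming (_∈_ to _∈ˡ_)
open import Data.List.Membership.Propositional.Properties using (∈-lookup)
open import Data.List.Relation.Binary.Subset.Propositional using () renaming (_⊆_ to _⊆ˡ_)
open import Data.Product using (Σ; ∃-syntax; _×_; _,_; proj₁; proj₂)
open import Data.Sum using (_⊎_; inj₁; inj₂)
import Data.Sum as Sum
open import Data.Empty using (⊥-elim)
open import Function using (id; _∘_)
open import Relation.Nullary using (Dec; yes; no; ¬?)
open import Relation.Nullary.Decidable using (_×-dec_; _→-dec_; map′; decidable-stable)
open import Relation.Binary.PropositionalEquality
  using (_≡_; _≢_; refl; cong; subst; subst₂) renaming (sym to ≡-sym)

x∈p─q⇒x∉q : ∀ {m} (p q : Subset m) {x} → x ∈ p ─ q → x ∉ q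
x∈p─q⇒x∉q (_ ∷ᵛ p) (_ ∷ᵛ q) (there x∈p─q) (there x∈q) = x∈p─q⇒x∉q p q x∈p─q x∈q
x∈p─q⇒x∉q (_ ∷ᵛ _) (inside ∷ᵛ _) () here

x∈p-y⇒x≢y : ∀ {m} {p : Subset m} {x y} → x ∈ p - y → x ≢ y
x∈p-y⇒x≢y {p = p} {y = y} x∈p-y refl = x∈p─q⇒x∉q p ⁅ y ⁆ x∈p-y (x∈⁅x⁆ y)

x∈p-y⇒x∈p : ∀ {m} {p : Subset m} {x y} → x ∈ p - y → x ∈ p
x∈p-y⇒x∈p {p = p} {y = y} = p─q⊆p p ⁅ y ⁆

p⊆q⇒p-x⊆q-x : ∀ {m} {p q : Subset m} {x} → p ⊆ q → p - x ⊆ q - x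
p⊆q⇒p-x⊆q-x p⊆q y∈p-x = x∈p∧x≢y⇒x∈p-y (p⊆q (x∈p-y⇒x∈p y∈p-x)) (x∈p-y⇒x≢y y∈p-x)

fromList : ∀ {m} → List (Fin m) → Subset m
fromList []       = ⊥
fromList (x ∷ xs) = ⁅ x ⁆ ∪ fromList xs

∈fromList⁺ : ∀ {m} {xs : List (Fin m)} {x} → x ∈ˡ xs → x ∈ fromList xs
∈fromList⁺ {xs = y ∷ xs} (here refl)  = p⊆p∪q (fromList xs) (x∈⁅x⁆ y)
∈fromList⁺ {xs = y ∷ xs} (there x∈xs) = q⊆p∪q ⁅ y ⁆ (fromList xs) (∈fromList⁺ x∈xs)

∈fromList⁻ : ∀ {m} (xs : List (Fin m)) {x} → x ∈ fromList xs → x ∈ˡ xs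
∈fromList⁻ []       x∈⊥ = ⊥-elim (∉⊥ x∈⊥)
∈fromList⁻ (y ∷ xs) x∈  with x∈p∪q⁻ ⁅ y ⁆ (fromList xs) x∈
... | inj₁ x∈⁅y⁆ = here (x∈⁅y⁆⇒x≡y y x∈⁅y⁆)
... | inj₂ x∈xs  = there (∈fromList⁻ xs x∈xs)

lookup-injective : ∀ {a} {A : Set a} {xs : List A} → Unique xs →
                   ∀ {i j} → lookup xs i ≡ lookup xs j → i ≡ j
lookup-injective {xs = _ ∷ _} _ {zero} {zero} _ = refl
lookup-injective {xs = _ ∷ xs} (x∉xs ∷ _) {zero} {suc j} x≡xs[j] =
  ⊥-elim (All.lookup x∉xs (∈-lookup j) x≡xs[j])
lookup-injective {xs = _ ∷ xs} (x∉xs ∷ _) {suc i} {zero} xs[i]≡x =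
  ⊥-elim (All.lookup x∉xs (∈-lookup i) (≡-sym xs[i]≡x))
lookup-injective {xs = _ ∷ _} (_ ∷ xs-unique) {suc i} {suc j} eq =
  cong suc (lookup-injective xs-unique eq)

unique⇒length≤ : ∀ {m} {xs : List (Fin m)} → Unique xs → length xs ≤ m
unique⇒length≤ xs-unique = injective⇒≤ (lookup-injective xs-unique)

module _ {n : ℕ} (G : SimpleGraph n) where

  open import Data.List.Membership.DecPropositional (_≟_ {n}) using () renaming (_∈?_ to _∈ˡ?_)

  -- Walks and reachability

  Reachable : Subset n → Fin n → Fin n → Set
  Reachable S u v = ∃[ l ] Walk G S u v l

  IsPath : ∀ {S u v l} → Walk G S u v l → Set
  IsPath P = Unique (verts G P)

  source∈ : ∀ {S u v l} → Walk G S u v l → u ∈ S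
  source∈ [ u∈S ]        = u∈S
  source∈ (step u∈S _ _) = u∈S

  target∈ : ∀ {S u v l} → Walk G S u v l → v ∈ S
  target∈ [ v∈S ]       = v∈S
  target∈ (step _ _ W) = target∈ W

  source∈verts : ∀ {S u v l} (W : Walk G S u v l) → u ∈ˡ verts G W
  source∈verts [ _ ]        = here refl
  source∈verts (step _ _ _) = here refl

  target∈verts : ∀ {S u v l} (W : Walk G S u v l) → v ∈ˡ verts G W
  target∈verts [ _ ]        = here refl
  target∈verts (step _ _ W) = there (target∈verts W)

  verts∈ : ∀ {S u v l} (W : Walk G S u v l) → All (_∈ S) (verts G W)
  verts∈ [ u∈S ]        = u∈S ∷ []
  verts∈ (step u∈S _ W) = u∈S ∷ verts∈ W

  restrict : ∀ {S T u v l} (W : Walk G S u v l) → All (_∈ T) (verts G W) → Walk G T u v l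
  restrict [ _ ]        (u∈T ∷ [])  = [ u∈T ]
  restrict (step _ e W) (u∈T ∷ W∈T) = step u∈T e (restrict W W∈T)

  verts-restrict : ∀ {S T u v l} (W : Walk G S u v l) (W∈T : All (_∈ T) (verts G W)) →
                   verts G (restrict W W∈T) ≡ verts G W
  verts-restrict [ _ ]        (_ ∷ [])  = refl
  verts-restrict (step _ _ W) (_ ∷ W∈T) = cong (_ ∷_) (verts-restrict W W∈T)

  walk-mono : ∀ {S T u v l} → S ⊆ T → Walk G S u v l → Walk G T u v l
  walk-mono S⊆T W = restrict W (All.map S⊆T (verts∈ W))

  infixr 5 _++ʷ_
  _++ʷ_ : ∀ {S u w v l m} → Walk G S u w l → Walk G S w v m → Walk G S u v (l + m)
  [ _ ]          ++ʷ W = W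
  step u∈S e V ++ʷ W = step u∈S e (V ++ʷ W)

  reverse : ∀ {S u v l} → Walk G S u v l → Walk G S v u l
  reverse [ u∈S ] = [ u∈S ]
  reverse {S} {u} {v} {suc l} (step u∈S e W) =
    subst (Walk G S v u) (+-comm l 1) (reverse W ++ʷ step (source∈ W) (sym G e) [ u∈S ])

  reachable-refl : ∀ {S u} → u ∈ S → Reachable S u u
  reachable-refl u∈S = 0 , [ u∈S ]

  reachable-sym : ∀ {S u v} → Reachable S u v → Reachable S v u
  reachable-sym (l , W) = l , reverse W

  reachable-trans : ∀ {S u w v} → Reachable S u w → Reachable S w v → Reachable S u v
  reachable-trans (l , V) (m , W) = l + m , V ++ʷ W

  reachable-mono : ∀ {S T u v} → S ⊆ T → Reachable S u v → Reachable T u v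
  reachable-mono S⊆T (l , W) = l , walk-mono S⊆T W

  reachable-avoiding⇒target≢ : ∀ {S x z t} → Reachable (S - x) z t → t ≢ x
  reachable-avoiding⇒target≢ (_ , W) = x∈p-y⇒x≢y (target∈ W)

  suffix : ∀ {S u v l z} (W : Walk G S u v l) → z ∈ˡ verts G W →
           ∃[ l' ] (l' ≤ l × Σ (Walk G S z v l') λ W' →
             verts G W' ⊆ˡ verts G W × (IsPath W → IsPath W'))
  suffix W@([ _ ])       (here refl)  = _ , ≤-refl , W , id , id
  suffix W@(step _ _ _)  (here refl)  = _ , ≤-refl , W , id , id
  suffix (step _ _ W)    (there z∈W) =
    let (l' , l'≤l , W' , W'⊆W , path⇒path) = suffix W z∈W
    in  l' , m≤n⇒m≤1+n l'≤l , W' , there ∘ W'⊆W , path⇒path ∘ AllPairs.tail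

  walk⇒path : ∀ {S u v l} → Walk G S u v l → ∃[ l' ] (l' ≤ l × Σ (Walk G S u v l') IsPath)
  walk⇒path [ u∈S ] = 0 , z≤n , [ u∈S ] , [] ∷ []
  walk⇒path {u = u} (step u∈S e W) with walk⇒path W
  ... | l' , l'≤l , P , P-path with u ∈ˡ? verts G P
  ...   | yes u∈P = let (l'' , l''≤l' , P' , _ , P'-path) = suffix P u∈P
                    in  l'' , m≤n⇒m≤1+n (≤-trans l''≤l' l'≤l) , P' , P'-path P-path
  ...   | no u∉P  = suc l' , s≤s l'≤l , step u∈S e P , ¬Any⇒All¬ (verts G P) u∉P ∷ P-path

  -- Nonseparable vertex sets

  Nonseparable : Subset n → Set
  Nonseparable S = Connected G S × NoCutVertex G S

  Attached : Subset n → Fin n → Fin n → Subset n → Set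
  Attached T u y C = ∀ {x z} → z ∈ C → z ≢ x → Reachable (T - x) z u ⊎ Reachable (T - x) z y

  attached-swap : ∀ {T u y C} → Attached T u y C → Attached T y u C
  attached-swap attached z∈C z≢x = Sum.swap (attached z∈C z≢x)

  attached-∪ : ∀ {T u y C D} → Attached T u y C → Attached T u y D → Attached T u y (C ∪ D)
  attached-∪ {C = C} {D} C-attached D-attached z∈C∪D z≢x with x∈p∪q⁻ C D z∈C∪D
  ... | inj₁ z∈C = C-attached z∈C z≢x
  ... | inj₂ z∈D = D-attached z∈D z≢x

  -- x occurs at most once on P, so one of the two segments of P from z avoids it.
  path-reaches-end-avoiding :
    ∀ {S T a b l x z} (P : Walk G S a b l) → IsPath P → All (_∈ T) (verts G P) →
    z ∈ˡ verts G P → z ≢ x → Reachable (T - x) z a ⊎ Reachable (T - x) z b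
  path-reaches-end-avoiding [ _ ] _ (z∈T ∷ []) (here refl) z≢x =
    inj₁ (reachable-refl (x∈p∧x≢y⇒x∈p-y z∈T z≢x))
  path-reaches-end-avoiding (step _ _ _) _ (z∈T ∷ _) (here refl) z≢x =
    inj₁ (reachable-refl (x∈p∧x≢y⇒x∈p-y z∈T z≢x))
  path-reaches-end-avoiding {a = a} {x = x} (step _ e P) (a∉P ∷ P-path) (a∈T ∷ P∈T) (there z∈P) z≢x
    with a ≟ x
  ... | yes refl =
    let (_ , _ , P' , P'⊆P , _) = suffix P z∈P
        P'∈T-a = All.tabulate λ w∈P' →
          x∈p∧x≢y⇒x∈p-y (All.lookup P∈T (P'⊆P w∈P')) λ { refl → All.lookup a∉P (P'⊆P w∈P') refl }
    in  inj₂ (_ , restrict P' P'∈T-a)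
  ... | no a≢x with path-reaches-end-avoiding P P-path P∈T z∈P z≢x
  ...   | inj₂ z↝b = inj₂ z↝b
  ...   | inj₁ z↝w =
    let w∈T-x = x∈p∧x≢y⇒x∈p-y (All.lookup P∈T (source∈verts P)) (reachable-avoiding⇒target≢ z↝w)
    in  inj₁ (reachable-trans z↝w (1 , step w∈T-x (sym G e) [ x∈p∧x≢y⇒x∈p-y a∈T a≢x ]))

  path-attached : ∀ {S T u y l} (P : Walk G S u y l) → IsPath P → All (_∈ T) (verts G P) →
                  Attached T u y (fromList (verts G P))
  path-attached P P-path P∈T z∈P =
    path-reaches-end-avoiding P P-path P∈T (∈fromList⁻ (verts G P) z∈P)

  connected-via : ∀ {S h} → (∀ {z} → z ∈ S → Reachable S z h) → Connected G S
  connected-via to-h z∈S w∈S = reachable-trans (to-h z∈S) (reachable-sym (to-h w∈S))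

  nonseparable-reachable-avoiding :
    ∀ {C T a b x} → Nonseparable C → C ⊆ T → a ∈ C → b ∈ C → a ≢ x → b ≢ x →
    Reachable (T - x) a b
  nonseparable-reachable-avoiding {C} {x = x} (connected , no-cut) C⊆T a∈C b∈C a≢x b≢x
    with x ∈? C
  ... | yes x∈C = reachable-mono (p⊆q⇒p-x⊆q-x C⊆T)
                    (no-cut x∈C (x∈p∧x≢y⇒x∈p-y a∈C a≢x) (x∈p∧x≢y⇒x∈p-y b∈C b≢x))
  ... | no x∉C  = reachable-mono (λ w∈C → x∈p∧x≢y⇒x∈p-y (C⊆T w∈C) λ { refl → x∉C w∈C })
                    (connected a∈C b∈C)

  nonseparable-attached-via :
    ∀ {C T u y w} → Nonseparable C → C ⊆ T → u ∈ C → w ∈ C → w ≢ u →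
    Reachable (T - u) w y → Attached T u y C
  nonseparable-attached-via {u = u} C-ns C⊆T u∈C w∈C w≢u w↝y {x} z∈C z≢x with u ≟ x
  ... | yes refl =
    inj₂ (reachable-trans (nonseparable-reachable-avoiding C-ns C⊆T z∈C w∈C z≢x w≢u) w↝y)
  ... | no u≢x   = inj₁ (nonseparable-reachable-avoiding C-ns C⊆T z∈C u∈C z≢x u≢x)

  nonseparable-attached : ∀ {C T u y} → Nonseparable C → C ⊆ T → u ∈ C → y ∈ C → y ≢ u →
                          Attached T u y C
  nonseparable-attached C-ns C⊆T u∈C y∈C y≢u =
    nonseparable-attached-via C-ns C⊆T u∈C y∈C y≢u (reachable-refl (x∈p∧x≢y⇒x∈p-y (C⊆T y∈C) y≢u))

  nonseparable-by-terminals :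
    ∀ {T u y} → Reachable T u y → Attached T u y T →
    (∀ {x} → u ≢ x → y ≢ x → Reachable (T - x) u y) → Nonseparable T
  nonseparable-by-terminals {T} {u} {y} u↝y attached bridge = connected-via to-u , no-cut
    where
    avoiding-u : ∀ {z} → z ∈ T → z ≢ u → Reachable (T - u) z y
    avoiding-u z∈T z≢u with attached z∈T z≢u
    ... | inj₁ z↝u = ⊥-elim (reachable-avoiding⇒target≢ z↝u refl)
    ... | inj₂ z↝y = z↝y

    to-u : ∀ {z} → z ∈ T → Reachable T z u
    to-u {z} z∈T with z ≟ u
    ... | yes refl = reachable-refl z∈T
    ... | no z≢u   =
      reachable-trans (reachable-mono x∈p-y⇒x∈p (avoiding-u z∈T z≢u)) (reachable-sym u↝y)

    to-u-avoiding : ∀ {x z} → u ≢ x → z ∈ T - x → Reachable (T - x) z u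
    to-u-avoiding u≢x z∈T-x with attached (x∈p-y⇒x∈p z∈T-x) (x∈p-y⇒x≢y z∈T-x)
    ... | inj₁ z↝u = z↝u
    ... | inj₂ z↝y =
      reachable-trans z↝y (reachable-sym (bridge u≢x (reachable-avoiding⇒target≢ z↝y)))

    no-cut : NoCutVertex G T
    no-cut {x} _ with u ≟ x
    ... | yes refl = connected-via λ z∈T-u → avoiding-u (x∈p-y⇒x∈p z∈T-u) (x∈p-y⇒x≢y z∈T-u)
    ... | no u≢x   = connected-via (to-u-avoiding u≢x)

  nonseparable-∪-path :
    ∀ {B S u y l} → Nonseparable B → u ∈ B → y ∈ B → u ≢ y →
    (P : Walk G S u y l) → IsPath P → Nonseparable (B ∪ fromList (verts G P))
  nonseparable-∪-path {B} B-ns@(B-connected , _) u∈B y∈B u≢y P P-path =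
    nonseparable-by-terminals
      (reachable-mono B⊆T (B-connected u∈B y∈B))
      (attached-∪ (nonseparable-attached B-ns B⊆T u∈B y∈B (u≢y ∘ ≡-sym))
                  (path-attached P P-path (All.tabulate (q⊆p∪q B _ ∘ ∈fromList⁺))))
      (nonseparable-reachable-avoiding B-ns B⊆T u∈B y∈B)
    where
    B⊆T : B ⊆ B ∪ fromList (verts G P)
    B⊆T = p⊆p∪q _

  nonseparable-cycle :
    ∀ {S S' u y l l'} (P : Walk G S u y l) → IsPath P → (P' : Walk G S' u y l') → IsPath P' →
    (∀ {w} → w ∈ˡ verts G P → w ∈ˡ verts G P' → w ≡ u ⊎ w ≡ y) →
    Nonseparable (fromList (verts G P) ∪ fromList (verts G P'))
  nonseparable-cycle {u = u} {y} P P-path P' P'-path internally-disjoint =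
    nonseparable-by-terminals
      (_ , restrict P P∈T)
      (attached-∪ (path-attached P P-path P∈T) (path-attached P' P'-path P'∈T))
      bridge
    where
    T : Subset n
    T = fromList (verts G P) ∪ fromList (verts G P')
    P∈T : All (_∈ T) (verts G P)
    P∈T = All.tabulate (p⊆p∪q _ ∘ ∈fromList⁺)
    P'∈T : All (_∈ T) (verts G P')
    P'∈T = All.tabulate (q⊆p∪q _ _ ∘ ∈fromList⁺)

    avoiding : ∀ {x} xs → All (_∈ T) xs → x ∉ fromList xs → All (_∈ T - x) xs
    avoiding xs xs∈T x∉xs = All.tabulate λ {w} w∈xs →
      x∈p∧x≢y⇒x∈p-y (All.lookup xs∈T w∈xs) λ { refl → x∉xs (∈fromList⁺ w∈xs) }

    bridge : ∀ {x} → u ≢ x → y ≢ x → Reachable (T - x) u y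
    bridge {x} u≢x y≢x with x ∈? fromList (verts G P) | x ∈? fromList (verts G P')
    ... | no x∉P | _       = _ , restrict P (avoiding (verts G P) P∈T x∉P)
    ... | _      | no x∉P' = _ , restrict P' (avoiding (verts G P') P'∈T x∉P')
    ... | yes x∈P | yes x∈P' with internally-disjoint (∈fromList⁻ _ x∈P) (∈fromList⁻ _ x∈P')
    ...   | inj₁ refl = ⊥-elim (u≢x refl)
    ...   | inj₂ refl = ⊥-elim (y≢x refl)

  nonseparable-triangle :
    ∀ {B C D u v w} → Nonseparable B → Nonseparable C → Nonseparable D →
    u ∈ B → v ∈ B → u ∈ C → w ∈ C → v ∈ D → w ∈ D → v ≢ u → w ≢ u → w ≢ v →
    Nonseparable (B ∪ C ∪ D)
  nonseparable-triangle {B} {C} {D} B-ns@(B-connected , _) C-ns D-ns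
                        u∈B v∈B u∈C w∈C v∈D w∈D v≢u w≢u w≢v =
    nonseparable-by-terminals
      (reachable-mono B⊆T (B-connected u∈B v∈B))
      (attached-∪ (nonseparable-attached B-ns B⊆T u∈B v∈B v≢u)
        (attached-∪ (nonseparable-attached-via C-ns C⊆T u∈C w∈C w≢u
                       (nonseparable-reachable-avoiding D-ns D⊆T w∈D v∈D w≢u v≢u))
                    (attached-swap (nonseparable-attached-via D-ns D⊆T v∈D w∈D w≢v
                       (nonseparable-reachable-avoiding C-ns C⊆T w∈C u∈C w≢v (v≢u ∘ ≡-sym))))))
      (nonseparable-reachable-avoiding B-ns B⊆T u∈B v∈B)
    where
    B⊆T : B ⊆ B ∪ C ∪ D
    B⊆T = p⊆p∪q _
    C⊆T : C ⊆ B ∪ C ∪ D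
    C⊆T = q⊆p∪q B _ ∘ p⊆p∪q D
    D⊆T : D ⊆ B ∪ C ∪ D
    D⊆T = q⊆p∪q B _ ∘ q⊆p∪q C D

  nonseparable-⁅⁆ : ∀ u → Nonseparable ⁅ u ⁆
  nonseparable-⁅⁆ u = connected , no-cut
    where
    connected : Connected G ⁅ u ⁆
    connected a∈⁅u⁆ b∈⁅u⁆ with x∈⁅y⁆⇒x≡y u a∈⁅u⁆ | x∈⁅y⁆⇒x≡y u b∈⁅u⁆
    ... | refl | refl = reachable-refl a∈⁅u⁆
    no-cut : NoCutVertex G ⁅ u ⁆
    no-cut x∈⁅u⁆ a∈⁅u⁆-x _ with x∈⁅y⁆⇒x≡y u x∈⁅u⁆ | x∈⁅y⁆⇒x≡y u (x∈p-y⇒x∈p a∈⁅u⁆-x)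
    ... | refl | refl = ⊥-elim (x∈p-y⇒x≢y a∈⁅u⁆-x refl)

  -- Decidability and existence of blocks

  walk? : ∀ S u v l → Dec (Walk G S u v l)
  walk? S u v zero with u ∈? S | u ≟ v
  ... | yes u∈S | yes refl = yes [ u∈S ]
  ... | no u∉S  | _        = no λ { [ u∈S ] → u∉S u∈S }
  ... | yes _   | no u≢v   = no λ { [ _ ] → u≢v refl }
  walk? S u v (suc l) with u ∈? S | any? (λ w → adj? G u w ×-dec walk? S w v l)
  ... | yes u∈S | yes (w , e , W) = yes (step u∈S e W)
  ... | no u∉S  | _               = no λ { (step u∈S _ _) → u∉S u∈S }
  ... | yes _   | no no-next      = no λ { (step _ e W) → no-next (_ , e , W) }

  length-verts : ∀ {S u v l} (W : Walk G S u v l) → length (verts G W) ≡ suc l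
  length-verts [ _ ]        = refl
  length-verts (step _ _ W) = cong suc (length-verts W)

  path-length< : ∀ {S u v l} (P : Walk G S u v l) → IsPath P → l < n
  path-length< P P-path = subst (_≤ n) (length-verts P) (unique⇒length≤ P-path)

  reachable? : ∀ S u v → Dec (Reachable S u v)
  reachable? S u v = map′ (λ (i , W) → toℕ i , W) short-path (any? λ i → walk? S u v (toℕ i))
    where
    short-path : Reachable S u v → ∃[ i ] Walk G S u v (toℕ i)
    short-path (_ , W) =
      let (l , _ , P , P-path) = walk⇒path W
          l<n = path-length< P P-path
      in  fromℕ< l<n , subst (Walk G S u v) (≡-sym (toℕ-fromℕ< l<n)) P

  connected? : ∀ S → Dec (Connected G S)
  connected? S = map′ (λ reach u∈S v∈S → reach _ _ u∈S v∈S) (λ conn _ _ → conn)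
    (all? λ u → all? λ v → u ∈? S →-dec v ∈? S →-dec reachable? S u v)

  nonseparable? : ∀ S → Dec (Nonseparable S)
  nonseparable? S = connected? S ×-dec
    map′ (λ conn x∈S → conn _ x∈S) (λ no-cut _ → no-cut)
      (all? λ x → x ∈? S →-dec connected? (S - x))

  block-containing : ∀ {T} → Nonempty T → Nonseparable T → ∃[ B ] (IsBlock G B × T ⊆ B)
  block-containing = grow (<-wellFounded _)
    where
    grow : ∀ {T} → Acc _<_ (n ∸ ∣ T ∣) → Nonempty T → Nonseparable T → ∃[ B ] (IsBlock G B × T ⊆ B)
    grow {T} (acc smaller) (x , x∈T) T-ns with anySubset? (λ T' → T ⊂? T' ×-dec nonseparable? T')
    ... | yes (T' , T⊂T'@(T⊆T' , _) , T'-ns) =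
      let (B , B-block , T'⊆B) = grow (smaller (∸-monoʳ-< (p⊂q⇒∣p∣<∣q∣ T⊂T') (∣p∣≤n T')))
                                      (x , T⊆T' x∈T) T'-ns
      in  B , B-block , T'⊆B ∘ T⊆T'
    ... | no no-larger = T , ((x , x∈T) , proj₁ T-ns , proj₂ T-ns , maximal) , id
      where
      maximal : ∀ T' → T ⊆ T' → Nonempty T' → Connected G T' → NoCutVertex G T' → T' ⊆ T
      maximal T' T⊆T' _ T'-connected T'-no-cut {y} y∈T' with y ∈? T
      ... | yes y∈T = y∈T
      ... | no y∉T  = ⊥-elim (no-larger (T' , (T⊆T' , y , y∈T' , y∉T) , T'-connected , T'-no-cut))

  -- Blocks and fault-tolerant mutual visibility

  block-nonseparable : ∀ {B} → IsBlock G B → Nonseparable B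
  block-nonseparable (_ , B-connected , B-no-cut , _) = B-connected , B-no-cut

  block-maximal : ∀ {B T} → IsBlock G B → B ⊆ T → Nonseparable T → T ⊆ B
  block-maximal ((x , x∈B) , _ , _ , maximal) B⊆T (T-connected , T-no-cut) =
    maximal _ B⊆T (x , B⊆T x∈B) T-connected T-no-cut

  closed-path-trivial : ∀ {S u l} (P : Walk G S u u l) → IsPath P → verts G P ≡ u ∷ []
  closed-path-trivial [ _ ]        _           = refl
  closed-path-trivial (step _ _ P) (u∉P ∷ _) = ⊥-elim (All.lookup u∉P (target∈verts P) refl)

  path⊆block : ∀ {B S u v l} → IsBlock G B → (P : Walk G S u v l) → IsPath P → u ∈ B → v ∈ B →
               All (_∈ B) (verts G P)
  path⊆block {B} {u = u} {v} B-block P P-path u∈B v∈B with u ≟ v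
  ... | yes refl = subst (All (_∈ B)) (≡-sym (closed-path-trivial P P-path)) (u∈B ∷ [])
  ... | no u≢v   = All.tabulate λ z∈P →
    block-maximal B-block (p⊆p∪q _)
      (nonseparable-∪-path (block-nonseparable B-block) u∈B v∈B u≢v P P-path)
      (q⊆p∪q B _ (∈fromList⁺ z∈P))

  shortcut-in-block : ∀ {B S u v l} → IsBlock G B → u ∈ B → v ∈ B → Walk G S u v l →
                      ∃[ l' ] (l' ≤ l × Walk G B u v l')
  shortcut-in-block B-block u∈B v∈B W =
    let (l' , l'≤l , P , P-path) = walk⇒path W
    in  l' , l'≤l , restrict P (path⊆block B-block P P-path u∈B v∈B)

  restrict-shortest :
    ∀ {S T u v l} (P : Walk G S u v l) → IsShortestPath G P → (P∈T : All (_∈ T) (verts G P)) →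
    (∀ {l'} → Walk G T u v l' → ∃[ l'' ] (l'' ≤ l' × Walk G S u v l'')) →
    IsShortestPath G (restrict P P∈T)
  restrict-shortest P (P-path , minimal) P∈T shortcut rewrite verts-restrict P P∈T =
    P-path , λ l' W → let (l'' , l''≤l' , W') = shortcut W in ≤-trans (minimal l'' W') l''≤l'

  -- The body of IsFtmv at a non-adjacent pair u, v.
  VisibilityPaths : Subset n → ℕ → Subset n → Fin n → Fin n → Set
  VisibilityPaths S k X u v =
    Σ (Fin (suc k) → ∃[ l ] Walk G S u v l) λ Q →
      (∀ i → let (_ , P) = Q i in
             IsShortestPath G P ×
             (∀ {w} → w ∈ˡ verts G P → w ∈ X → w ≡ u ⊎ w ≡ v)) ×
      (∀ i j → i ≢ j → let (_ , P) = Q i ; (_ , P') = Q j in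
             ∀ {w} → w ∈ˡ verts G P → w ∈ˡ verts G P' → w ≡ u ⊎ w ≡ v)

  ftmv-transfer :
    ∀ {S T k X} → X ⊆ T →
    (∀ {u v l} → u ∈ X → v ∈ X → (P : Walk G S u v l) → IsPath P → All (_∈ T) (verts G P)) →
    (∀ {u v l} → u ∈ X → v ∈ X → Walk G T u v l → ∃[ l' ] (l' ≤ l × Walk G S u v l')) →
    IsFtmv G S k X → IsFtmv G T k X
  ftmv-transfer {S} {T} {k} {X} X⊆T paths-stay shortcut (_ , visible) = X⊆T , λ u∈X v∈X u≢v ¬adj →
    restrict-paths u∈X v∈X (visible u∈X v∈X u≢v ¬adj)
    where
    restrict-paths : ∀ {u v} → u ∈ X → v ∈ X → VisibilityPaths S k X u v → VisibilityPaths T k X u v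
    restrict-paths {u} {v} u∈X v∈X (Q , shortest-avoiding , disjoint) =
      Q' , (λ i → restrict-shortest (path i) (proj₁ (shortest-avoiding i)) (path∈T i)
                                    (shortcut u∈X v∈X)
                , proj₂ (shortest-avoiding i) ∘ back i)
         , λ i j i≢j w∈Q'i w∈Q'j → disjoint i j i≢j (back i w∈Q'i) (back j w∈Q'j)
      where
      path : ∀ i → Walk G S u v (proj₁ (Q i))
      path i = proj₂ (Q i)
      path∈T : ∀ i → All (_∈ T) (verts G (path i))
      path∈T i = paths-stay u∈X v∈X (path i) (proj₁ (proj₁ (shortest-avoiding i)))
      Q' : Fin (suc k) → ∃[ l ] Walk G T u v l
      Q' i = _ , restrict (path i) (path∈T i)
      back : ∀ i {w} → w ∈ˡ verts G (proj₂ (Q' i)) → w ∈ˡ verts G (path i)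
      back i = subst (_ ∈ˡ_) (verts-restrict (path i) (path∈T i))

  block-ftmv⇒ftmv : ∀ {B k Y} → IsBlock G B → IsFtmv G B k Y → IsFtmv G ⊤ k Y
  block-ftmv⇒ftmv B-block Y-ftmv@(Y⊆B , _) =
    ftmv-transfer ⊆⊤ (λ _ _ P _ → All.tabulate λ _ → ∈⊤)
      (λ u∈Y v∈Y → shortcut-in-block B-block (Y⊆B u∈Y) (Y⊆B v∈Y)) Y-ftmv

  ftmv⇒block-ftmv : ∀ {B k X} → IsBlock G B → X ⊆ B → IsFtmv G ⊤ k X → IsFtmv G B k X
  ftmv⇒block-ftmv B-block X⊆B =
    ftmv-transfer X⊆B (λ u∈X v∈X P P-path → path⊆block B-block P P-path (X⊆B u∈X) (X⊆B v∈X))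
      (λ _ _ W → _ , ≤-refl , walk-mono ⊆⊤ W)

  block-ftmv≤maximum-ftmv : ∀ {B k X Y} → IsBlock G B → IsMaxFtmv G ⊤ k X → IsFtmv G B k Y →
                            ∣ Y ∣ ≤ ∣ X ∣
  block-ftmv≤maximum-ftmv B-block (_ , X-maximum) Y-ftmv =
    X-maximum _ (block-ftmv⇒ftmv B-block Y-ftmv)

  maximum-ftmv⇒block-maximum-ftmv : ∀ {B k X} → IsBlock G B → X ⊆ B → IsMaxFtmv G ⊤ k X →
                                    IsMaxFtmv G B k X
  maximum-ftmv⇒block-maximum-ftmv B-block X⊆B X-maximum@(X-ftmv , _) =
    ftmv⇒block-ftmv B-block X⊆B X-ftmv , λ _ → block-ftmv≤maximum-ftmv B-block X-maximum

  PairwiseNonseparable : Subset n → Set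
  PairwiseNonseparable X =
    ∀ {u v} → u ∈ X → v ∈ X → u ≢ v → ∃[ C ] (Nonseparable C × u ∈ C × v ∈ C)

  cycle-through :
    ∀ {S S' u v l l'} (P : Walk G S u v l) → IsPath P → (P' : Walk G S' u v l') → IsPath P' →
    (∀ {w} → w ∈ˡ verts G P → w ∈ˡ verts G P' → w ≡ u ⊎ w ≡ v) →
    ∃[ C ] (Nonseparable C × u ∈ C × v ∈ C)
  cycle-through P P-path P' P'-path internally-disjoint =
    _ , nonseparable-cycle P P-path P' P'-path internally-disjoint
      , p⊆p∪q _ (∈fromList⁺ (source∈verts P)) , p⊆p∪q _ (∈fromList⁺ (target∈verts P))

  ftmv⇒pairwise-nonseparable : ∀ {S k X} → 1 ≤ k → IsFtmv G S k X → PairwiseNonseparable X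
  ftmv⇒pairwise-nonseparable {k = suc _} _ (_ , visible) {u} {v} u∈X v∈X u≢v with adj? G u v
  ... | yes e = cycle-through edge edge-path edge edge-path λ where
                  (here refl)         _ → inj₁ refl
                  (there (here refl)) _ → inj₂ refl
    where
    edge : Walk G ⊤ u v 1
    edge = step ∈⊤ e [ ∈⊤ ]
    edge-path : IsPath edge
    edge-path = (u≢v ∷ []) ∷ [] ∷ []
  ... | no ¬adj with visible u∈X v∈X u≢v ¬adj
  ...   | Q , shortest-avoiding , disjoint =
    cycle-through (proj₂ (Q zero)) (proj₁ (proj₁ (shortest-avoiding zero)))
                  (proj₂ (Q (suc zero))) (proj₁ (proj₁ (shortest-avoiding (suc zero))))
                  (disjoint zero (suc zero) λ ())

  block-⊇⁅⁆ : ∀ {X} u → X ⊆ ⁅ u ⁆ → ∃[ B ] (IsBlock G B × X ⊆ B)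
  block-⊇⁅⁆ u X⊆⁅u⁆ =
    let (B , B-block , ⁅u⁆⊆B) = block-containing (u , x∈⁅x⁆ u) (nonseparable-⁅⁆ u)
    in  B , B-block , ⁅u⁆⊆B ∘ X⊆⁅u⁆

  block-absorbs-pairwise-nonseparable :
    ∀ {B X u v} → IsBlock G B → PairwiseNonseparable X →
    u ∈ X → v ∈ X → v ≢ u → u ∈ B → v ∈ B → X ⊆ B
  block-absorbs-pairwise-nonseparable {B} {u = u} {v} B-block pairwise u∈X v∈X v≢u u∈B v∈B {x} x∈X
    with x ≟ u | x ≟ v
  ... | yes refl | _        = u∈B
  ... | no _     | yes refl = v∈B
  ... | no x≢u   | no x≢v   =
    let (C , C-ns , u∈C , x∈C) = pairwise u∈X x∈X (x≢u ∘ ≡-sym)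
        (D , D-ns , v∈D , x∈D) = pairwise v∈X x∈X (x≢v ∘ ≡-sym)
    in  block-maximal B-block (p⊆p∪q _)
          (nonseparable-triangle (block-nonseparable B-block) C-ns D-ns
                                 u∈B v∈B u∈C x∈C v∈D x∈D v≢u x≢u x≢v)
          (q⊆p∪q B _ (p⊆p∪q D x∈C))

  pairwise-nonseparable⇒⊆block : ∀ {X} → Fin n → PairwiseNonseparable X →
                                 ∃[ B ] (IsBlock G B × X ⊆ B)
  pairwise-nonseparable⇒⊆block {X} z pairwise with nonempty? X
  ... | no X-empty = block-⊇⁅⁆ z λ x∈X → ⊥-elim (X-empty (_ , x∈X))
  ... | yes (u , u∈X) with any? (λ v → v ∈? X ×-dec ¬? (v ≟ u))
  ...   | no only-u = block-⊇⁅⁆ u λ {x} x∈X →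
    subst (_∈ ⁅ u ⁆) (≡-sym (decidable-stable (x ≟ u) λ x≢u → only-u (x , x∈X , x≢u))) (x∈⁅x⁆ u)
  ...   | yes (v , v∈X , v≢u) =
    let (C , C-ns , u∈C , v∈C) = pairwise u∈X v∈X (v≢u ∘ ≡-sym)
        (B , B-block , C⊆B)    = block-containing (u , u∈C) C-ns
    in  B , B-block ,
        block-absorbs-pairwise-nonseparable B-block pairwise u∈X v∈X v≢u (C⊆B u∈C) (C⊆B v∈C)

proposition3p3 : ∀ {n} (G : SimpleGraph n) (k : ℕ) → 1 ≤ k → 2 ≤ n → Connected G ⊤ →
    (∀ X → IsMaxFtmv G ⊤ k X → ∃[ B ] (IsBlock G B × X ⊆ B)) ×
    (∀ m → IsFμ G ⊤ k m →
      (∀ B → IsBlock G B → ∀ mB → IsFμ G B k mB → mB ≤ m) ×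
      ∃[ B ] (IsBlock G B × IsFμ G B k m))
proposition3p3 G k 1≤k 2≤n _ = (λ _ → ftmv⊆block ∘ proj₁) , fμ-attained-in-block
  where
  ftmv⊆block : ∀ {X} → IsFtmv G ⊤ k X → ∃[ B ] (IsBlock G B × X ⊆ B)
  ftmv⊆block = pairwise-nonseparable⇒⊆block G (fromℕ< 2≤n) ∘ ftmv⇒pairwise-nonseparable G 1≤k

  fμ-attained-in-block : ∀ m → IsFμ G ⊤ k m →
    (∀ B → IsBlock G B → ∀ mB → IsFμ G B k mB → mB ≤ m) × ∃[ B ] (IsBlock G B × IsFμ G B k m)
  fμ-attained-in-block m (X , X-maximum , ∣X∣≡m) =
    (λ B B-block mB (Y , (Y-ftmv , _) , ∣Y∣≡mB) →
       subst₂ _≤_ ∣Y∣≡mB ∣X∣≡m (block-ftmv≤maximum-ftmv G B-block X-maximum Y-ftmv)) ,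
    (let (B , B-block , X⊆B) = ftmv⊆block (proj₁ X-maximum)
     in  B , B-block , X , maximum-ftmv⇒block-maximum-ftmv G B-block X⊆B X-maximum , ∣X∣≡m)
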